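{- For every integer $n\ge 1$, $R_n(x)=\sum_{k=0}^{n-1}R_{n,k}x^k$ equals the lattice polynomial $L_{2n,n}(x)$, where $R_{n,k}$ is the number of even trees with $2n$ edges and $r$-index equal to $k$.
   Context: Lattice polynomials: for nonnegative integers $i,j$, $L_{i,j}(x)$ is the sum, over all lattice paths from $(0,0)$ to $(i,j)$ consisting of unit east steps $(1,0)$ and unit north steps $(0,1)$ all of whose points $(a,b)$ satisfy $2b\le a$ (i.e. no step goes above the line $x=2y$), of the weight of the path. The weight of a path is the product of the weights of its steps, where a north step from $(a,b)$ to $(a,b+1)$ has weight $x$ if $a$ is odd, and all other steps have weight $1$. An even tree is a plane (rooted, ordered) tree in which every vertex has an even number of children. The degree of a vertex is its number of children. If a vertex has $2k$ children, its first $k$ children (in the plane order) are called left children and its last $k$ children are called right children; thus every non-root vertex is either a left child or a right child. The $r$-index $r(T)$ of an even tree $T$ is one half of the sum of the degrees of all right children in $T$. -}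

module Defs where

open import Data.Nat using (ℕ; zero; suc; _+_; _*_; _≤_; _/_)
open import Data.List using (List; []; _∷_; length; drop; map)
open import Data.Nat.ListAction using (sum)
open import Data.Product using (Σ; _×_; _,_)
open import Data.Unit using (⊤)
open import Relation.Binary.PropositionalEquality using (_≡_)

oddBit : ℕ → ℕ
oddBit zero = 0
oddBit (suc zero) = 1
oddBit (suc (suc n)) = oddBit n

data Step : Set where
  E N : Step

endpoint : ℕ → ℕ → List Step → ℕ × ℕ
endpoint a b [] = a , b
endpoint a b (E ∷ s) = endpoint (suc a) b s
endpoint a b (N ∷ s) = endpoint a (suc b) s

Below : ℕ → ℕ → List Step → Set
Below a b [] = 2 * b ≤ a
Below a b (E ∷ s) = (2 * b ≤ a) × Below (suc a) b s
Below a b (N ∷ s) = (2 * b ≤ a) × Below a (suc b) s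

-- exponent of x in the weight of a path started at (a , b):
-- a north step from (a , b) has weight x iff a is odd
weightExp : ℕ → ℕ → List Step → ℕ
weightExp a b [] = 0
weightExp a b (E ∷ s) = weightExp (suc a) b s
weightExp a b (N ∷ s) = oddBit a + weightExp a (suc b) s

-- Paths from (0,0) to (i,j) staying weakly below x = 2y with weight x^k.
-- The coefficient of x^k in L_{i,j}(x) is the number of elements of this type.
LPath : ℕ → ℕ → ℕ → Set
LPath i j k = Σ (List Step) λ s →
  (endpoint 0 0 s ≡ (i , j)) × Below 0 0 s × (weightExp 0 0 s ≡ k)

data Tree : Set where
  node : List Tree → Tree

deg : Tree → ℕ
deg (node cs) = length cs

mutual
  edges : Tree → ℕ
  edges (node cs) = length cs + edgesF cs

  edgesF : List Tree → ℕ
  edgesF [] = 0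
  edgesF (t ∷ ts) = edges t + edgesF ts

mutual
  IsEven : Tree → Set
  IsEven (node cs) = (oddBit (length cs) ≡ 0) × IsEvenF cs

  IsEvenF : List Tree → Set
  IsEvenF [] = ⊤
  IsEvenF (t ∷ ts) = IsEven t × IsEvenF ts

mutual
  -- sum of the degrees of all right children in the tree: a vertex with
  -- 2k children has as right children its last k children
  rightDegSum : Tree → ℕ
  rightDegSum (node cs) = sum (map deg (drop (length cs / 2) cs)) + rightDegSumF cs

  rightDegSumF : List Tree → ℕ
  rightDegSumF [] = 0
  rightDegSumF (t ∷ ts) = rightDegSum t + rightDegSumF ts

rIndex : Tree → ℕ
rIndex t = rightDegSum t / 2

-- even trees with 2n edges and r-index k; R_{n,k} is the number of elements
RTree : ℕ → ℕ → Set
RTree n k = Σ Tree λ t → IsEven t × (edges t ≡ 2 * n) × (rIndex t ≡ k)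

module Submission where

-- Both sides of the identity R_n(x) = L_{2n,n}(x) are put in weight-preserving
-- bijection with one intermediate family: forests of "blocks", where a forest is
-- a finite sequence of blocks and a block is a pair (x , y) of forests.
--
-- Record a lattice path by its slack a - 2b, which the constraint keeps
-- nonnegative; an east step raises it by 1, a north step lowers it by 2 and has
-- weight x exactly when the slack is odd.  A forest placed at slack h is encoded
-- block by block: a block (x , y) becomes  E (x at slack h+1) E (y at slack h+2) N.
-- Decoding reads a path from right to left, maintaining a stack of unfinished
-- blocks (the type Parse), so that it is structurally recursive.  Paths from
-- (0,0) to (2n,n) below the line are exactly the encodings of forests at slack 0
-- with n blocks, and their weight is the forest weight (weight 0).
--
-- A forest at slack h becomes a vertex whose children come in pairs, one
-- pair per block: of the two forests x (slack h+1) and y (slack h+2) of a block,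
-- the one at even slack becomes a left child, the other one a right child.  Trees
-- obtained this way are exactly the even trees; edges count twice the blocks, and
-- the right-degree sum is twice the weight.  The theorem is the composition of
-- the two bijections, and the vanishing of the coefficients for k ≥ n is the
-- bound  weight 0 f < size f  for nonempty forests.

open import Defs
open import Data.Nat using (ℕ; zero; suc; _+_; _∸_; _*_; _/_; _≤_; _<_; _⊓_; z≤n; s≤s)
open import Data.Nat.Properties
open import Data.Nat.DivMod using (m*n/n≡m)
open import Data.Nat.ListAction using (sum)
open import Data.Nat.Tactic.RingSolver using (solve-∀)
open import Data.List using (List; []; _∷_; _++_; length; take; drop; map)
open import Data.List.Properties using (length-++; map-++; length-map; take-map; drop-map; length-take; length-drop; take++drop≡id)
open import Data.Product using (Σ; _×_; _,_; proj₁; proj₂)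
open import Data.Product.Properties using (≡-dec)
open import Data.Empty using (⊥)
open import Data.Unit using (tt)
open import Relation.Nullary using (¬_; Irrelevant)
import Relation.Unary as Unary
open import Relation.Binary.PropositionalEquality
open import Axiom.UniquenessOfIdentityProofs using (module Decidable⇒UIP)
open import Function.Bundles using (_↔_; mk↔ₛ′; Inverse)
open import Function.Properties.Inverse using (↔-sym; ↔-trans)

open ≡-Reasoning

Σ-↔ : {A B : Set} {P : A → Set} {Q : B → Set} →
  Unary.Irrelevant P → Unary.Irrelevant Q →
  (f : A → B) (g : B → A) →
  (∀ {a} → P a → Q (f a)) → (∀ {b} → Q b → P (g b)) →
  (∀ {a} → P a → g (f a) ≡ a) → (∀ {b} → Q b → f (g b) ≡ b) →
  Σ A P ↔ Σ B Q
Σ-↔ irrP irrQ f g fP gQ gf fg =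
  mk↔ₛ′ (λ (a , p) → f a , fP p) (λ (b , q) → g b , gQ q)
        (λ (b , q) → Σ-≡ irrQ (fg q)) (λ (a , p) → Σ-≡ irrP (gf p))
  where
  Σ-≡ : {C : Set} {R : C → Set} → Unary.Irrelevant R →
    ∀ {c c′} {r : R c} {r′ : R c′} → c ≡ c′ → (c , r) ≡ (c′ , r′)
  Σ-≡ irr refl = cong (_ ,_) (irr _ _)

cong₃ : {A B C D : Set} (φ : A → B → C → D) {a a′ : A} {b b′ : B} {c c′ : C} →
  a ≡ a′ → b ≡ b′ → c ≡ c′ → φ a b c ≡ φ a′ b′ c′
cong₃ φ refl refl refl = refl

×-irrelevant : {X Y : Set} → Irrelevant X → Irrelevant Y → Irrelevant (X × Y)
×-irrelevant irrX irrY (x , y) (x′ , y′) = cong₂ _,_ (irrX x x′) (irrY y y′)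

oddBit-+-double : ∀ m b → oddBit (m + 2 * b) ≡ oddBit m
oddBit-+-double m zero = cong oddBit (+-identityʳ m)
oddBit-+-double m (suc b) rewrite *-suc 2 b | +-suc m (suc (2 * b)) | +-suc m (2 * b) =
  oddBit-+-double m b

oddBit≤1 : ∀ h → oddBit h ≤ 1
oddBit≤1 zero = z≤n
oddBit≤1 (suc zero) = s≤s z≤n
oddBit≤1 (suc (suc h)) = oddBit≤1 h

oddBit-double : ∀ n → oddBit (n + n) ≡ 0
oddBit-double zero = refl
oddBit-double (suc n) rewrite +-suc n n = oddBit-double n

even⇒double : ∀ n → oddBit n ≡ 0 → Σ ℕ λ m → n ≡ m + m
even⇒double zero _ = 0 , refl
even⇒double (suc (suc n)) even with even⇒double n even
... | m , n≡m+m = suc m , cong suc (trans (cong suc n≡m+m) (sym (+-suc m m)))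

double-half : ∀ n → 2 * n / 2 ≡ n
double-half n = trans (cong (_/ 2) (*-comm 2 n)) (m*n/n≡m n 2)

half-double : ∀ n → (n + n) / 2 ≡ n
half-double n = trans (cong (λ m → (n + m) / 2) (sym (+-identityʳ n))) (double-half n)

take-++-exact : {A : Set} (xs ys : List A) {m : ℕ} → length xs ≡ m → take m (xs ++ ys) ≡ xs
take-++-exact [] [] refl = refl
take-++-exact [] (_ ∷ _) refl = refl
take-++-exact (x ∷ xs) ys refl = cong (x ∷_) (take-++-exact xs ys refl)

drop-++-exact : {A : Set} (xs ys : List A) {m : ℕ} → length xs ≡ m → drop m (xs ++ ys) ≡ ys
drop-++-exact [] ys refl = refl
drop-++-exact (x ∷ xs) ys refl = drop-++-exact xs ys refl

half-length : {A : Set} (xs ys : List A) → length xs ≡ length ys →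
  length (xs ++ ys) / 2 ≡ length xs
half-length xs ys eq =
  trans (cong (_/ 2) (trans (length-++ xs) (cong (length xs +_) (sym eq))))
        (half-double (length xs))

length-take-half : {A : Set} (xs : List A) (m : ℕ) → length xs ≡ m + m → length (take m xs) ≡ m
length-take-half xs m eq =
  trans (length-take m xs) (trans (cong (m ⊓_) eq) (m≤n⇒m⊓n≡m (m≤m+n m m)))

length-drop-half : {A : Set} (xs : List A) (m : ℕ) → length xs ≡ m + m → length (drop m xs) ≡ m
length-drop-half xs m eq =
  trans (length-drop m xs) (trans (cong (_∸ m) eq) (m+n∸m≡n m m))

data Forest : Set where
  leaf  : Forest
  block : Forest → Forest → Forest → Forest   -- block x y r : block (x , y), then r

_++ᶠ_ : Forest → Forest → Forest
leaf ++ᶠ t = t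
block x y r ++ᶠ t = block x y (r ++ᶠ t)

++ᶠ-identityʳ : ∀ f → f ++ᶠ leaf ≡ f
++ᶠ-identityʳ leaf = refl
++ᶠ-identityʳ (block x y r) = cong (block x y) (++ᶠ-identityʳ r)

++ᶠ-assoc : ∀ f g t → (f ++ᶠ g) ++ᶠ t ≡ f ++ᶠ (g ++ᶠ t)
++ᶠ-assoc leaf g t = refl
++ᶠ-assoc (block x y r) g t = cong (block x y) (++ᶠ-assoc r g t)

blocks : Forest → ℕ
blocks leaf = 0
blocks (block _ _ r) = suc (blocks r)

size : Forest → ℕ
size leaf = 0
size (block x y r) = size x + (size y + suc (size r))

weight : ℕ → Forest → ℕ
weight h leaf = 0
weight h (block x y r) = weight (suc h) x + (weight (suc (suc h)) y + (oddBit h + weight h r))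

weight-mod2 : ∀ h f → weight (suc (suc h)) f ≡ weight h f
weight-mod2 h leaf = refl
weight-mod2 h (block x y r) =
  cong₂ _+_ (weight-mod2 (suc h) x) (cong₂ _+_ (weight-mod2 (suc (suc h)) y) (cong (oddBit h +_) (weight-mod2 h r)))

-- each block counts at most 1
weight≤size : ∀ h f → weight h f ≤ size f
weight≤size h leaf = z≤n
weight≤size h (block x y r) =
  +-mono-≤ (weight≤size (suc h) x) (+-mono-≤ (weight≤size (suc (suc h)) y) (+-mono-≤ (oddBit≤1 h) (weight≤size h r)))

-- At even slack the outermost blocks count 0, so a nonempty forest has weight
-- strictly below its size; this is why R_{n,k} = 0 for k ≥ n.
weight<size : ∀ f → 1 ≤ size f → weight 0 f < size f
weight<size (block x y r) _ =
  +-mono-≤-< (weight≤size 1 x) (+-mono-≤-< (weight≤size 2 y) (s≤s (weight≤size 0 r)))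

Forests : ℕ → ℕ → Set
Forests n k = Σ Forest λ f → size f ≡ n × weight 0 f ≡ k

mutual
  Valid : ℕ → List Step → Set
  Valid h [] = h ≡ 0
  Valid h (E ∷ s) = Valid (suc h) s
  Valid h (N ∷ s) = ValidAfterN h s

  ValidAfterN : ℕ → List Step → Set
  ValidAfterN (suc (suc h)) s = Valid h s
  ValidAfterN _ _ = ⊥

slackWeight : ℕ → List Step → ℕ
slackWeight h [] = 0
slackWeight h (E ∷ s) = slackWeight (suc h) s
slackWeight h (N ∷ s) = oddBit h + slackWeight (h ∸ 2) s

easts norths : List Step → ℕ
easts [] = 0
easts (E ∷ s) = suc (easts s)
easts (N ∷ s) = easts s
norths [] = 0
norths (E ∷ s) = norths s
norths (N ∷ s) = suc (norths s)

endpoint-counts : ∀ a b s → endpoint a b s ≡ (a + easts s , b + norths s)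
endpoint-counts a b [] = cong₂ _,_ (sym (+-identityʳ a)) (sym (+-identityʳ b))
endpoint-counts a b (E ∷ s) = trans (endpoint-counts (suc a) b s) (cong (_, b + norths s) (sym (+-suc a (easts s))))
endpoint-counts a b (N ∷ s) = trans (endpoint-counts a (suc b) s) (cong (a + easts s ,_) (sym (+-suc b (norths s))))

-- A north step from the point (h + 2 + 2b , b) leads to slack h.
north-slack : ∀ h b → suc (suc h) + 2 * b ≡ h + 2 * suc b
north-slack = solve-∀

below-head : ∀ a b s → Below a b s → 2 * b ≤ a
below-head a b [] p = p
below-head a b (E ∷ s) (p , _) = p
below-head a b (N ∷ s) (p , _) = p

Below-irrelevant : ∀ a b s → Irrelevant (Below a b s)
Below-irrelevant a b [] = ≤-irrelevant
Below-irrelevant a b (E ∷ s) = ×-irrelevant ≤-irrelevant (Below-irrelevant (suc a) b s)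
Below-irrelevant a b (N ∷ s) = ×-irrelevant ≤-irrelevant (Below-irrelevant a (suc b) s)

north-needs-slack : ∀ h b s → Below (h + 2 * b) (suc b) s → 2 ≤ h
north-needs-slack h b s bl =
  +-cancelʳ-≤ (2 * b) 2 h (subst (_≤ h + 2 * b) (*-suc 2 b) (below-head (h + 2 * b) (suc b) s bl))

-- Translations between slack coordinates and the coordinates of Defs: a valid
-- path from slack h, started at (h + 2b , b), stays below the line, ends on
-- it, and has the same weight.
valid⇒balanced : ∀ h s → Valid h s → h + easts s ≡ 2 * norths s
valid⇒balanced h [] refl = refl
valid⇒balanced h (E ∷ s) v = trans (+-suc h (easts s)) (valid⇒balanced (suc h) s v)
valid⇒balanced (suc (suc h)) (N ∷ s) v =
  trans (cong (λ m → suc (suc m)) (valid⇒balanced h s v)) (sym (*-suc 2 (norths s)))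

valid⇒below : ∀ h b s → Valid h s → Below (h + 2 * b) b s
valid⇒below h b [] refl = ≤-refl
valid⇒below h b (E ∷ s) v = m≤n+m (2 * b) h , valid⇒below (suc h) b s v
valid⇒below (suc (suc h)) b (N ∷ s) v =
  m≤n+m (2 * b) (suc (suc h)) , subst (λ a → Below a (suc b) s) (sym (north-slack h b)) (valid⇒below h (suc b) s v)

valid⇒weightExp : ∀ h b s → Valid h s → weightExp (h + 2 * b) b s ≡ slackWeight h s
valid⇒weightExp h b [] _ = refl
valid⇒weightExp h b (E ∷ s) v = valid⇒weightExp (suc h) b s v
valid⇒weightExp (suc (suc h)) b (N ∷ s) v =
  cong₂ _+_ (oddBit-+-double (suc (suc h)) b)
            (trans (cong (λ a → weightExp a (suc b) s) (north-slack h b)) (valid⇒weightExp h (suc b) s v))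

below⇒valid : ∀ h b s → Below (h + 2 * b) b s → h + easts s ≡ 2 * norths s → Valid h s
below⇒valid h b [] _ balanced = trans (sym (+-identityʳ h)) balanced
below⇒valid h b (E ∷ s) (_ , bl) balanced =
  below⇒valid (suc h) b s bl (trans (sym (+-suc h (easts s))) balanced)
below⇒valid h b (N ∷ s) (_ , bl) balanced with north-needs-slack h b s bl
... | s≤s (s≤s {n = h′} _) =
  below⇒valid h′ (suc b) s (subst (λ a → Below a (suc b) s) (north-slack h′ b) bl)
    (suc-injective (suc-injective (trans balanced (*-suc 2 (norths s)))))

lattice⇒valid : ∀ n s → endpoint 0 0 s ≡ (2 * n , n) → Below 0 0 s → Valid 0 s × norths s ≡ n
lattice⇒valid n s ends bl =
  below⇒valid 0 0 s bl (trans easts≡2n (cong (2 *_) (sym norths≡n))) , norths≡n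
  where
  easts≡2n : easts s ≡ 2 * n
  easts≡2n = cong proj₁ (trans (sym (endpoint-counts 0 0 s)) ends)
  norths≡n : norths s ≡ n
  norths≡n = cong proj₂ (trans (sym (endpoint-counts 0 0 s)) ends)

valid⇒lattice : ∀ s → Valid 0 s →
  endpoint 0 0 s ≡ (2 * norths s , norths s) × Below 0 0 s × weightExp 0 0 s ≡ slackWeight 0 s
valid⇒lattice s v =
  trans (endpoint-counts 0 0 s) (cong (_, norths s) (valid⇒balanced 0 s v)) ,
  valid⇒below 0 0 s v , valid⇒weightExp 0 0 s v

encode : ℕ → Forest → List Step → List Step
encode h leaf s = s
encode h (block x y r) s = E ∷ encode (suc h) x (E ∷ encode (suc (suc h)) y (N ∷ encode h r s))

encode-++ᶠ : ∀ h f t s → encode h (f ++ᶠ t) s ≡ encode h f (encode h t s)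
encode-++ᶠ h leaf t s = refl
encode-++ᶠ h (block x y r) t s =
  cong (λ z → E ∷ encode (suc h) x (E ∷ encode (suc (suc h)) y (N ∷ z))) (encode-++ᶠ h r t s)

valid-encode : ∀ h f s → Valid h s → Valid h (encode h f s)
valid-encode h leaf s v = v
valid-encode h (block x y r) s v =
  valid-encode (suc h) x _ (valid-encode (suc (suc h)) y _ (valid-encode h r s v))

norths-encode : ∀ h f s → norths (encode h f s) ≡ size f + norths s
norths-encode h leaf s = refl
norths-encode h (block x y r) s =
  begin
    norths (encode (suc h) x (E ∷ encode (suc (suc h)) y (N ∷ encode h r s)))
  ≡⟨ norths-encode (suc h) x _ ⟩
    size x + norths (encode (suc (suc h)) y (N ∷ encode h r s))
  ≡⟨ cong (size x +_) (norths-encode (suc (suc h)) y _) ⟩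
    size x + (size y + suc (norths (encode h r s)))
  ≡⟨ cong (λ m → size x + (size y + suc m)) (norths-encode h r s) ⟩
    size x + (size y + suc (size r + norths s))
  ≡⟨ reassoc (size x) (size y) (size r) (norths s) ⟩
    size (block x y r) + norths s
  ∎
  where
  reassoc : ∀ a b c d → a + (b + suc (c + d)) ≡ a + (b + suc c) + d
  reassoc = solve-∀

slackWeight-encode : ∀ h f s → slackWeight h (encode h f s) ≡ weight h f + slackWeight h s
slackWeight-encode h leaf s = refl
slackWeight-encode h (block x y r) s =
  begin
    slackWeight (suc h) (encode (suc h) x (E ∷ encode (suc (suc h)) y (N ∷ encode h r s)))
  ≡⟨ slackWeight-encode (suc h) x _ ⟩
    weight (suc h) x + slackWeight (suc (suc h)) (encode (suc (suc h)) y (N ∷ encode h r s))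
  ≡⟨ cong (weight (suc h) x +_) (slackWeight-encode (suc (suc h)) y _) ⟩
    weight (suc h) x + (weight (suc (suc h)) y + (oddBit h + slackWeight h (encode h r s)))
  ≡⟨ cong (λ m → weight (suc h) x + (weight (suc (suc h)) y + (oddBit h + m))) (slackWeight-encode h r s) ⟩
    weight (suc h) x + (weight (suc (suc h)) y + (oddBit h + (weight h r + slackWeight h s)))
  ≡⟨ reassoc (weight (suc h) x) (weight (suc (suc h)) y) (oddBit h) (weight h r) (slackWeight h s) ⟩
    weight h (block x y r) + slackWeight h s
  ∎
  where
  reassoc : ∀ a b c d e → a + (b + (c + (d + e))) ≡ a + (b + (c + d)) + e
  reassoc = solve-∀

-- A parsed valid path from slack h: a forest at slack h followed, when h > 0,
-- by the rest of the block that is still open around it.  In  inY f g  the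
-- forest f completes the y-part of a block and is followed by N and g; in
-- inX f y g  it completes the x-part and is followed by E, y, N and g.
data Parse : ℕ → Set where
  done : Forest → Parse 0
  inY  : ∀ {h} → Forest → Parse h → Parse (suc (suc h))
  inX  : ∀ {h} → Forest → Forest → Parse h → Parse (suc h)

unparse : ∀ {h} → Parse h → List Step
unparse (done f) = encode 0 f []
unparse (inY {h} f g) = encode (suc (suc h)) f (N ∷ unparse g)
unparse (inX {h} f y g) = encode (suc h) f (E ∷ encode (suc (suc h)) y (N ∷ unparse g))

prepend : ∀ {h} → Forest → Parse h → Parse h
prepend f (done t) = done (f ++ᶠ t)
prepend f (inY t g) = inY (f ++ᶠ t) g
prepend f (inX t y g) = inX (f ++ᶠ t) y g

prepend-leaf : ∀ {h} (g : Parse h) → prepend leaf g ≡ g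
prepend-leaf (done t) = refl
prepend-leaf (inY t g) = refl
prepend-leaf (inX t y g) = refl

prepend-++ᶠ : ∀ {h} f t (g : Parse h) → prepend f (prepend t g) ≡ prepend (f ++ᶠ t) g
prepend-++ᶠ f t (done u) = cong done (sym (++ᶠ-assoc f t u))
prepend-++ᶠ f t (inY u g) = cong (λ z → inY z g) (sym (++ᶠ-assoc f t u))
prepend-++ᶠ f t (inX u y g) = cong (λ z → inX z y g) (sym (++ᶠ-assoc f t u))

-- reading an east step: it opens the x-part of a new block or, if an x-part was
-- pending, closes that block
consE : ∀ {h} → Parse (suc h) → Parse h
consE (inY y g) = inX leaf y g
consE (inX x y g) = prepend (block x y leaf) g

-- the value returned on invalid input
junk : ∀ h → Parse h
junk zero = done leaf
junk (suc h) = inX leaf leaf (junk h)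

-- reading a north step: it opens the y-part of a new block
consN : ∀ h → Parse (h ∸ 2) → Parse h
consN (suc (suc h)) g = inY leaf g
consN h _ = junk h

parse : ∀ h → List Step → Parse h
parse h [] = junk h
parse h (E ∷ s) = consE (parse (suc h) s)
parse h (N ∷ s) = consN h (parse (h ∸ 2) s)

unparse-prepend : ∀ {h} f (g : Parse h) → unparse (prepend f g) ≡ encode h f (unparse g)
unparse-prepend f (done t) = encode-++ᶠ 0 f t []
unparse-prepend f (inY {h} t g) = encode-++ᶠ (suc (suc h)) f t (N ∷ unparse g)
unparse-prepend f (inX {h} t y g) = encode-++ᶠ (suc h) f t (E ∷ encode (suc (suc h)) y (N ∷ unparse g))

unparse-consE : ∀ {h} (g : Parse (suc h)) → unparse (consE g) ≡ E ∷ unparse g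
unparse-consE (inY y g) = refl
unparse-consE (inX x y g) = unparse-prepend (block x y leaf) g

valid-unparse : ∀ {h} (g : Parse h) → Valid h (unparse g)
valid-unparse (done f) = valid-encode 0 f [] refl
valid-unparse (inY f g) = valid-encode _ f _ (valid-unparse g)
valid-unparse (inX f y g) =
  valid-encode _ f _ (valid-encode _ y _ (valid-unparse g))

unparse-parse : ∀ h s → Valid h s → unparse (parse h s) ≡ s
unparse-parse h [] refl = refl
unparse-parse h (E ∷ s) v = trans (unparse-consE (parse (suc h) s)) (cong (E ∷_) (unparse-parse (suc h) s v))
unparse-parse (suc (suc h)) (N ∷ s) v = cong (N ∷_) (unparse-parse h s v)

parse-encode : ∀ h f s → parse h (encode h f s) ≡ prepend f (parse h s)
parse-encode h leaf s = sym (prepend-leaf (parse h s))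
parse-encode h (block x y r) s =
  begin
    consE (parse (suc h) (encode (suc h) x (E ∷ encode (suc (suc h)) y (N ∷ encode h r s))))
  ≡⟨ cong consE (parse-encode (suc h) x _) ⟩
    consE (prepend x (consE (parse (suc (suc h)) (encode (suc (suc h)) y (N ∷ encode h r s)))))
  ≡⟨ cong (λ g → consE (prepend x (consE g))) (parse-encode (suc (suc h)) y _) ⟩
    consE (prepend x (consE (inY (y ++ᶠ leaf) (parse h (encode h r s)))))
  ≡⟨ cong₂ (λ y′ g → consE (prepend x (consE (inY y′ g)))) (++ᶠ-identityʳ y) (parse-encode h r s) ⟩
    consE (inX (x ++ᶠ leaf) y (prepend r (parse h s)))
  ≡⟨ cong (λ x′ → consE (inX x′ y (prepend r (parse h s)))) (++ᶠ-identityʳ x) ⟩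
    prepend (block x y leaf) (prepend r (parse h s))
  ≡⟨ prepend-++ᶠ (block x y leaf) r (parse h s) ⟩
    prepend (block x y r) (parse h s)
  ∎

parse-unparse : ∀ {h} (g : Parse h) → parse h (unparse g) ≡ g
parse-unparse (done f) =
  trans (parse-encode 0 f []) (cong done (++ᶠ-identityʳ f))
parse-unparse (inY {h} f g) =
  begin
    parse (suc (suc h)) (encode (suc (suc h)) f (N ∷ unparse g))
  ≡⟨ parse-encode _ f _ ⟩
    prepend f (inY leaf (parse h (unparse g)))
  ≡⟨ cong₂ inY (++ᶠ-identityʳ f) (parse-unparse g) ⟩
    inY f g
  ∎
parse-unparse (inX {h} f y g) =
  begin
    parse (suc h) (encode (suc h) f (E ∷ encode (suc (suc h)) y (N ∷ unparse g)))
  ≡⟨ parse-encode _ f _ ⟩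
    prepend f (consE (parse (suc (suc h)) (encode (suc (suc h)) y (N ∷ unparse g))))
  ≡⟨ cong (λ z → prepend f (consE z)) (parse-encode _ y _) ⟩
    prepend f (consE (inY (y ++ᶠ leaf) (parse h (unparse g))))
  ≡⟨ cong₃ inX (++ᶠ-identityʳ f) (++ᶠ-identityʳ y) (parse-unparse g) ⟩
    inX f y g
  ∎

forestOf : Parse 0 → Forest
forestOf (done f) = f

decode : List Step → Forest
decode s = forestOf (parse 0 s)

decode-encode : ∀ f → decode (encode 0 f []) ≡ f
decode-encode f = cong forestOf (parse-unparse (done f))

encode-decode : ∀ s → Valid 0 s → encode 0 (decode s) [] ≡ s
encode-decode s v = trans (unparse-done (parse 0 s)) (unparse-parse 0 s v)
  where
  unparse-done : (g : Parse 0) → encode 0 (forestOf g) [] ≡ unparse g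
  unparse-done (done f) = refl

norths-path : ∀ f → norths (encode 0 f []) ≡ size f
norths-path f = trans (norths-encode 0 f []) (+-identityʳ (size f))

slackWeight-path : ∀ f → slackWeight 0 (encode 0 f []) ≡ weight 0 f
slackWeight-path f = trans (slackWeight-encode 0 f []) (+-identityʳ (weight 0 f))

pathIso : ∀ n k → Forests n k ↔ LPath (2 * n) n k
pathIso n k =
  Σ-↔ (×-irrelevant ≡-irrelevant ≡-irrelevant)
      (×-irrelevant (Decidable⇒UIP.≡-irrelevant (≡-dec _≟_ _≟_))
                    (×-irrelevant (Below-irrelevant 0 0 _) ≡-irrelevant))
      (λ f → encode 0 f []) decode to from
      (λ {f} _ → decode-encode f)
      (λ { {s} (ends , bl , _) → encode-decode s (proj₁ (lattice⇒valid n s ends bl)) })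
  where
  to : ∀ {f} → size f ≡ n × weight 0 f ≡ k →
    endpoint 0 0 (encode 0 f []) ≡ (2 * n , n) × Below 0 0 (encode 0 f []) × weightExp 0 0 (encode 0 f []) ≡ k
  to {f} (size≡n , weight≡k) with valid⇒lattice _ (valid-encode 0 f [] refl)
  ... | ends , bl , wexp =
    subst (λ m → endpoint 0 0 (encode 0 f []) ≡ (2 * m , m)) (trans (norths-path f) size≡n) ends ,
    bl ,
    trans wexp (trans (slackWeight-path f) weight≡k)
  from : ∀ {s} → endpoint 0 0 s ≡ (2 * n , n) × Below 0 0 s × weightExp 0 0 s ≡ k →
    size (decode s) ≡ n × weight 0 (decode s) ≡ k
  from {s} (ends , bl , wexp) with lattice⇒valid n s ends bl
  ... | v , norths≡n =
    trans (sym (norths-path (decode s))) (trans (cong norths (encode-decode s v)) norths≡n) ,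
    trans (sym (slackWeight-path (decode s)))
          (trans (cong (slackWeight 0) (encode-decode s v)) (trans (sym (valid⇒weightExp 0 0 s v)) wexp))

-- the side of a vertex: the root counts as a left child
data Side : Set where
  left right : Side

-- forests of left children live at even slack, those of right children at odd slack
parity : Side → ℕ
parity left = 0
parity right = 1

-- Each block of the forest gives the vertex one left and one right child; of the
-- block's forests x (slack h+1) and y (slack h+2), the one at even slack becomes
-- the left child.
mutual
  tree : Side → Forest → Tree
  tree s f = node (lefts s f ++ rights s f)

  lefts : Side → Forest → List Tree
  lefts _ leaf = []
  lefts left (block x y r) = tree left y ∷ lefts left r
  lefts right (block x y r) = tree left x ∷ lefts right r

  rights : Side → Forest → List Tree
  rights _ leaf = []
  rights left (block x y r) = tree right x ∷ rights left r
  rights right (block x y r) = tree right y ∷ rights right r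

pairUp : Side → List Forest → List Forest → Forest
pairUp left (l ∷ ls) (r ∷ rs) = block r l (pairUp left ls rs)
pairUp right (l ∷ ls) (r ∷ rs) = block l r (pairUp right ls rs)
pairUp _ _ _ = leaf

mutual
  untree : Side → Tree → Forest
  untree s (node cs) =
    pairUp s (take (length cs / 2) (untreeAll left cs)) (drop (length cs / 2) (untreeAll right cs))

  -- map (untree s), written out so that termination is evident
  untreeAll : Side → List Tree → List Forest
  untreeAll s [] = []
  untreeAll s (c ∷ cs) = untree s c ∷ untreeAll s cs

untreeAll-map : ∀ s cs → untreeAll s cs ≡ map (untree s) cs
untreeAll-map s [] = refl
untreeAll-map s (c ∷ cs) = cong (untree s c ∷_) (untreeAll-map s cs)

length-lefts : ∀ s f → length (lefts s f) ≡ blocks f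
length-lefts s leaf = refl
length-lefts left (block x y r) = cong suc (length-lefts left r)
length-lefts right (block x y r) = cong suc (length-lefts right r)

length-rights : ∀ s f → length (rights s f) ≡ blocks f
length-rights s leaf = refl
length-rights left (block x y r) = cong suc (length-rights left r)
length-rights right (block x y r) = cong suc (length-rights right r)

length-children : ∀ s f → length (lefts s f ++ rights s f) ≡ blocks f + blocks f
length-children s f = trans (length-++ (lefts s f)) (cong₂ _+_ (length-lefts s f) (length-rights s f))

equal-halves : ∀ s f → length (lefts s f) ≡ length (rights s f)
equal-halves s f = trans (length-lefts s f) (sym (length-rights s f))

untree-node : ∀ s ls rs → length ls ≡ length rs →
  untree s (node (ls ++ rs)) ≡ pairUp s (map (untree left) ls) (map (untree right) rs)
untree-node s ls rs eq =
  begin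
    pairUp s (take m (untreeAll left (ls ++ rs))) (drop m (untreeAll right (ls ++ rs)))
  ≡⟨ cong₂ (λ as bs → pairUp s (take m as) (drop m bs))
           (trans (untreeAll-map left (ls ++ rs)) (map-++ (untree left) ls rs))
           (trans (untreeAll-map right (ls ++ rs)) (map-++ (untree right) ls rs)) ⟩
    pairUp s (take m (map (untree left) ls ++ map (untree left) rs))
             (drop m (map (untree right) ls ++ map (untree right) rs))
  ≡⟨ cong₂ (pairUp s) (take-++-exact _ _ first-half) (drop-++-exact _ _ first-half) ⟩
    pairUp s (map (untree left) ls) (map (untree right) rs)
  ∎
  where
  m = length (ls ++ rs) / 2
  first-half : ∀ {φ : Tree → Forest} → length (map φ ls) ≡ m
  first-half {φ} = trans (length-map φ ls) (sym (half-length ls rs eq))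

mutual
  untree-tree : ∀ s f → untree s (tree s f) ≡ f
  untree-tree s f = trans (untree-node s (lefts s f) (rights s f) (equal-halves s f)) (pairUp-untree s f)

  pairUp-untree : ∀ s f → pairUp s (map (untree left) (lefts s f)) (map (untree right) (rights s f)) ≡ f
  pairUp-untree left leaf = refl
  pairUp-untree right leaf = refl
  pairUp-untree left (block x y r) =
    cong₃ block (untree-tree right x) (untree-tree left y) (pairUp-untree left r)
  pairUp-untree right (block x y r) =
    cong₃ block (untree-tree left x) (untree-tree right y) (pairUp-untree right r)

lefts-pairUp : ∀ s ls rs → length ls ≡ length rs → lefts s (pairUp s ls rs) ≡ map (tree left) ls
lefts-pairUp left [] [] _ = refl
lefts-pairUp right [] [] _ = refl
lefts-pairUp left (l ∷ ls) (r ∷ rs) eq = cong (tree left l ∷_) (lefts-pairUp left ls rs (suc-injective eq))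
lefts-pairUp right (l ∷ ls) (r ∷ rs) eq = cong (tree left l ∷_) (lefts-pairUp right ls rs (suc-injective eq))

rights-pairUp : ∀ s ls rs → length ls ≡ length rs → rights s (pairUp s ls rs) ≡ map (tree right) rs
rights-pairUp left [] [] _ = refl
rights-pairUp right [] [] _ = refl
rights-pairUp left (l ∷ ls) (r ∷ rs) eq = cong (tree right r ∷_) (rights-pairUp left ls rs (suc-injective eq))
rights-pairUp right (l ∷ ls) (r ∷ rs) eq = cong (tree right r ∷_) (rights-pairUp right ls rs (suc-injective eq))

length-untreeAll : ∀ s cs → length (untreeAll s cs) ≡ length cs
length-untreeAll s cs = trans (cong length (untreeAll-map s cs)) (length-map (untree s) cs)

mutual
  tree-untree : ∀ s t → IsEven t → tree s (untree s t) ≡ t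
  tree-untree s (node cs) (even , evens) with even⇒double (length cs) even
  ... | m , length≡ =
    trans (cong (λ q → tree s (pairUp s (take q (untreeAll left cs)) (drop q (untreeAll right cs))))
                (trans (cong (_/ 2) length≡) (half-double m)))
          (tree-halves s cs m length≡ evens)

  tree-halves : ∀ s cs m → length cs ≡ m + m → IsEvenF cs →
    tree s (pairUp s (take m (untreeAll left cs)) (drop m (untreeAll right cs))) ≡ node cs
  tree-halves s cs m length≡ evens =
    begin
      node (lefts s (pairUp s ls rs) ++ rights s (pairUp s ls rs))
    ≡⟨ cong₂ (λ as bs → node (as ++ bs))
             (lefts-pairUp s ls rs same-length) (rights-pairUp s ls rs same-length) ⟩
      node (map (tree left) ls ++ map (tree right) rs)
    ≡⟨ cong₂ (λ as bs → node (as ++ bs)) (sym (take-map m (untreeAll left cs))) (sym (drop-map m (untreeAll right cs))) ⟩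
      node (take m (map (tree left) (untreeAll left cs)) ++ drop m (map (tree right) (untreeAll right cs)))
    ≡⟨ cong₂ (λ as bs → node (take m as ++ drop m bs)) (map-tree-untree left cs evens) (map-tree-untree right cs evens) ⟩
      node (take m cs ++ drop m cs)
    ≡⟨ cong node (take++drop≡id m cs) ⟩
      node cs
    ∎
    where
    ls = take m (untreeAll left cs)
    rs = drop m (untreeAll right cs)
    same-length : length ls ≡ length rs
    same-length = trans (length-take-half _ m (trans (length-untreeAll left cs) length≡))
                        (sym (length-drop-half _ m (trans (length-untreeAll right cs) length≡)))

  map-tree-untree : ∀ s cs → IsEvenF cs → map (tree s) (untreeAll s cs) ≡ cs
  map-tree-untree s [] _ = refl
  map-tree-untree s (c ∷ cs) (even , evens) = cong₂ _∷_ (tree-untree s c even) (map-tree-untree s cs evens)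

IsEvenF-++ : ∀ xs ys → IsEvenF xs → IsEvenF ys → IsEvenF (xs ++ ys)
IsEvenF-++ [] ys _ evens = evens
IsEvenF-++ (x ∷ xs) ys (even , evens) evens′ = even , IsEvenF-++ xs ys evens evens′

-- a vertex built from a forest has blocks f + blocks f children
mutual
  tree-even : ∀ s f → IsEven (tree s f)
  tree-even s f =
    subst (λ d → oddBit d ≡ 0) (sym (length-children s f)) (oddBit-double (blocks f)) ,
    IsEvenF-++ (lefts s f) (rights s f) (lefts-even s f) (rights-even s f)

  lefts-even : ∀ s f → IsEvenF (lefts s f)
  lefts-even s leaf = tt
  lefts-even left (block x y r) = tree-even left y , lefts-even left r
  lefts-even right (block x y r) = tree-even left x , lefts-even right r

  rights-even : ∀ s f → IsEvenF (rights s f)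
  rights-even s leaf = tt
  rights-even left (block x y r) = tree-even right x , rights-even left r
  rights-even right (block x y r) = tree-even right y , rights-even right r

mutual
  IsEven-irrelevant : ∀ t → Irrelevant (IsEven t)
  IsEven-irrelevant (node cs) = ×-irrelevant ≡-irrelevant (IsEvenF-irrelevant cs)

  IsEvenF-irrelevant : ∀ cs → Irrelevant (IsEvenF cs)
  IsEvenF-irrelevant [] tt tt = refl
  IsEvenF-irrelevant (c ∷ cs) = ×-irrelevant (IsEven-irrelevant c) (IsEvenF-irrelevant cs)

-- Regrouping the contributions of one block: its two children, the two edges
-- to them (or the two unit weights of a block at odd slack), and the rest.
block-regroup : ∀ p L q R → (p + L) + (q + R) ≡ p + q + (L + R)
block-regroup = solve-∀

block-regroup-suc : ∀ b p L q R → suc b + suc b + ((p + L) + (q + R)) ≡ p + q + 2 + (b + b + (L + R))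
block-regroup-suc = solve-∀

edgesF-++ : ∀ xs ys → edgesF (xs ++ ys) ≡ edgesF xs + edgesF ys
edgesF-++ [] ys = refl
edgesF-++ (x ∷ xs) ys = trans (cong (edges x +_) (edgesF-++ xs ys)) (sym (+-assoc (edges x) _ _))

-- every block contributes two edges
mutual
  edges-tree : ∀ s f → edges (tree s f) ≡ 2 * size f
  edges-tree s f =
    trans (cong₂ _+_ (length-children s f) (edgesF-++ (lefts s f) (rights s f))) (children-edges s f)

  children-edges : ∀ s f → blocks f + blocks f + (edgesF (lefts s f) + edgesF (rights s f)) ≡ 2 * size f
  children-edges left leaf = refl
  children-edges right leaf = refl
  children-edges left (block x y r) =
    begin
      suc (blocks r) + suc (blocks r) +
        ((edges (tree left y) + edgesF (lefts left r)) + (edges (tree right x) + edgesF (rights left r)))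
    ≡⟨ block-regroup-suc (blocks r) (edges (tree left y)) _ (edges (tree right x)) _ ⟩
      edges (tree left y) + edges (tree right x) + 2 +
        (blocks r + blocks r + (edgesF (lefts left r) + edgesF (rights left r)))
    ≡⟨ cong₃ (λ p q c → p + q + 2 + c) (edges-tree left y) (edges-tree right x) (children-edges left r) ⟩
      2 * size y + 2 * size x + 2 + 2 * size r
    ≡⟨ double-size (size y) (size x) (size r) ⟩
      2 * size (block x y r)
    ∎
    where
    double-size : ∀ b a c → 2 * b + 2 * a + 2 + 2 * c ≡ 2 * (a + (b + suc c))
    double-size = solve-∀
  children-edges right (block x y r) =
    begin
      suc (blocks r) + suc (blocks r) +
        ((edges (tree left x) + edgesF (lefts right r)) + (edges (tree right y) + edgesF (rights right r)))
    ≡⟨ block-regroup-suc (blocks r) (edges (tree left x)) _ (edges (tree right y)) _ ⟩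
      edges (tree left x) + edges (tree right y) + 2 +
        (blocks r + blocks r + (edgesF (lefts right r) + edgesF (rights right r)))
    ≡⟨ cong₃ (λ p q c → p + q + 2 + c) (edges-tree left x) (edges-tree right y) (children-edges right r) ⟩
      2 * size x + 2 * size y + 2 + 2 * size r
    ≡⟨ double-size (size x) (size y) (size r) ⟩
      2 * size (block x y r)
    ∎
    where
    double-size : ∀ a b c → 2 * a + 2 * b + 2 + 2 * c ≡ 2 * (a + (b + suc c))
    double-size = solve-∀

-- The share of a subtree in the right-degree sum of the whole tree: its own
-- right-degree sum, plus its degree when its root is a right child.
charge : Side → Tree → ℕ
charge left t = rightDegSum t
charge right t = deg t + rightDegSum t

chargeSum : Side → List Tree → ℕ
chargeSum s [] = 0
chargeSum s (t ∷ ts) = charge s t + chargeSum s ts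

chargeSum-left : ∀ ts → rightDegSumF ts ≡ chargeSum left ts
chargeSum-left [] = refl
chargeSum-left (t ∷ ts) = cong (rightDegSum t +_) (chargeSum-left ts)

chargeSum-right : ∀ ts → sum (map deg ts) + rightDegSumF ts ≡ chargeSum right ts
chargeSum-right [] = refl
chargeSum-right (t ∷ ts) =
  trans (interchange (deg t) (sum (map deg ts)) (rightDegSum t) (rightDegSumF ts))
        (cong (deg t + rightDegSum t +_) (chargeSum-right ts))
  where
  interchange : ∀ a b c d → a + b + (c + d) ≡ a + c + (b + d)
  interchange = solve-∀

rightDegSumF-++ : ∀ xs ys → rightDegSumF (xs ++ ys) ≡ rightDegSumF xs + rightDegSumF ys
rightDegSumF-++ [] ys = refl
rightDegSumF-++ (x ∷ xs) ys =
  trans (cong (rightDegSum x +_) (rightDegSumF-++ xs ys)) (sym (+-assoc (rightDegSum x) _ _))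

rightDegSum-node : ∀ ls rs → length ls ≡ length rs →
  rightDegSum (node (ls ++ rs)) ≡ chargeSum left ls + chargeSum right rs
rightDegSum-node ls rs eq =
  begin
    sum (map deg (drop (length (ls ++ rs) / 2) (ls ++ rs))) + rightDegSumF (ls ++ rs)
  ≡⟨ cong₂ (λ d e → sum (map deg d) + e) (drop-++-exact ls rs (sym (half-length ls rs eq))) (rightDegSumF-++ ls rs) ⟩
    sum (map deg rs) + (rightDegSumF ls + rightDegSumF rs)
  ≡⟨ swap-front (sum (map deg rs)) (rightDegSumF ls) (rightDegSumF rs) ⟩
    rightDegSumF ls + (sum (map deg rs) + rightDegSumF rs)
  ≡⟨ cong₂ _+_ (chargeSum-left ls) (chargeSum-right rs) ⟩
    chargeSum left ls + chargeSum right rs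
  ∎
  where
  swap-front : ∀ a b c → a + (b + c) ≡ b + (a + c)
  swap-front = solve-∀

-- degree of tree s f when it is counted by its parent
ownDeg : Side → Forest → ℕ
ownDeg left f = 0
ownDeg right f = blocks f + blocks f

charge-tree : ∀ s f →
  charge s (tree s f) ≡ ownDeg s f + (chargeSum left (lefts s f) + chargeSum right (rights s f))
charge-tree left f = rightDegSum-node (lefts left f) (rights left f) (equal-halves left f)
charge-tree right f =
  cong₂ _+_ (length-children right f) (rightDegSum-node (lefts right f) (rights right f) (equal-halves right f))

mutual
  charge-weight : ∀ s f → charge s (tree s f) ≡ 2 * weight (parity s) f
  charge-weight s f = trans (charge-tree s f) (children-charge s f)

  children-charge : ∀ s f →
    ownDeg s f + (chargeSum left (lefts s f) + chargeSum right (rights s f)) ≡ 2 * weight (parity s) f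
  children-charge left leaf = refl
  children-charge right leaf = refl
  children-charge left (block x y r) =
    begin
      (charge left (tree left y) + chargeSum left (lefts left r)) +
        (charge right (tree right x) + chargeSum right (rights left r))
    ≡⟨ block-regroup (charge left (tree left y)) _ (charge right (tree right x)) _ ⟩
      charge left (tree left y) + charge right (tree right x) +
        (chargeSum left (lefts left r) + chargeSum right (rights left r))
    ≡⟨ cong₃ (λ p q c → p + q + c) (charge-weight left y) (charge-weight right x) (children-charge left r) ⟩
      2 * weight 0 y + 2 * weight 1 x + 2 * weight 0 r
    ≡⟨ cong (λ v → 2 * v + 2 * weight 1 x + 2 * weight 0 r) (sym (weight-mod2 0 y)) ⟩
      2 * weight 2 y + 2 * weight 1 x + 2 * weight 0 r
    ≡⟨ double-weight (weight 2 y) (weight 1 x) (weight 0 r) ⟩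
      2 * weight 0 (block x y r)
    ∎
    where
    double-weight : ∀ b a c → 2 * b + 2 * a + 2 * c ≡ 2 * (a + (b + (0 + c)))
    double-weight = solve-∀
  children-charge right (block x y r) =
    begin
      suc (blocks r) + suc (blocks r) +
        ((charge left (tree left x) + chargeSum left (lefts right r)) +
         (charge right (tree right y) + chargeSum right (rights right r)))
    ≡⟨ block-regroup-suc (blocks r) (charge left (tree left x)) _ (charge right (tree right y)) _ ⟩
      charge left (tree left x) + charge right (tree right y) + 2 +
        (blocks r + blocks r + (chargeSum left (lefts right r) + chargeSum right (rights right r)))
    ≡⟨ cong₃ (λ p q c → p + q + 2 + c) (charge-weight left x) (charge-weight right y) (children-charge right r) ⟩
      2 * weight 0 x + 2 * weight 1 y + 2 + 2 * weight 1 r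
    ≡⟨ cong₂ (λ u v → 2 * u + 2 * v + 2 + 2 * weight 1 r) (sym (weight-mod2 0 x)) (sym (weight-mod2 1 y)) ⟩
      2 * weight 2 x + 2 * weight 3 y + 2 + 2 * weight 1 r
    ≡⟨ double-weight (weight 2 x) (weight 3 y) (weight 1 r) ⟩
      2 * weight 1 (block x y r)
    ∎
    where
    double-weight : ∀ a b c → 2 * a + 2 * b + 2 + 2 * c ≡ 2 * (a + (b + (1 + c)))
    double-weight = solve-∀

rIndex-tree : ∀ f → rIndex (tree left f) ≡ weight 0 f
rIndex-tree f = trans (cong (_/ 2) (charge-weight left f)) (double-half (weight 0 f))

treeIso : ∀ n k → Forests n k ↔ RTree n k
treeIso n k =
  Σ-↔ (×-irrelevant ≡-irrelevant ≡-irrelevant)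
      (λ {t} → ×-irrelevant (IsEven-irrelevant t) (×-irrelevant ≡-irrelevant ≡-irrelevant))
      (tree left) (untree left) (λ {f} → to {f}) (λ {t} → from {t})
      (λ {f} _ → untree-tree left f)
      (λ { {t} (even , _) → tree-untree left t even })
  where
  to : ∀ {f} → size f ≡ n × weight 0 f ≡ k →
    IsEven (tree left f) × edges (tree left f) ≡ 2 * n × rIndex (tree left f) ≡ k
  to {f} (size≡n , weight≡k) =
    tree-even left f , trans (edges-tree left f) (cong (2 *_) size≡n) , trans (rIndex-tree f) weight≡k
  from : ∀ {t} → IsEven t × edges t ≡ 2 * n × rIndex t ≡ k →
    size (untree left t) ≡ n × weight 0 (untree left t) ≡ k
  from {t} (even , edges≡2n , rIndex≡k) =
    *-cancelˡ-≡ _ n 2 (trans (sym (edges-tree left (untree left t))) (trans (cong edges rebuilt) edges≡2n)) ,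
    trans (sym (rIndex-tree (untree left t))) (trans (cong rIndex rebuilt) rIndex≡k)
    where
    rebuilt : tree left (untree left t) ≡ t
    rebuilt = tree-untree left t even

mainTheorem2 : (n : ℕ) → 1 ≤ n → (k : ℕ) →
    ((k < n → RTree n k ↔ LPath (2 * n) n k) × (n ≤ k → ¬ LPath (2 * n) n k))
-- The coefficient sets agree through forests; for k ≥ n a path of weight k
-- would decode to a forest with n ≥ 1 blocks and weight ≥ n.
mainTheorem2 n 1≤n k =
  (λ _ → ↔-trans (↔-sym (treeIso n k)) (pathIso n k)) ,
  λ n≤k path →
    let (f , size≡n , weight≡k) = Inverse.from (pathIso n k) path in
    <⇒≱ (weight<size f (subst (1 ≤_) (sym size≡n) 1≤n)) (subst₂ _≤_ (sym size≡n) (sym weight≡k) n≤k)
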